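{- Let $\Gamma$ be a graph and let $\alpha$ and $\beta$ be two permutations of $V(\Gamma)$. Then $(\alpha,\beta)$ is a TFS-morphism of $\Gamma$ if and only if $\alpha\beta^{ -1}$ is a derangement and $(\alpha,\beta)$ is a TF-morphism of the complement $\overline{\Gamma}$.
   Context: All graphs are finite, undirected and simple. For a permutation $\alpha$ and point $x$, $x^\alpha$ denotes the image; permutations are composed left to right, $x^{\alpha\beta}=(x^\alpha)^\beta$. A derangement is a permutation fixing no point. A TF-morphism of a graph $\Lambda$ is a pair $(\alpha,\beta)$ of permutations of $V(\Lambda)$ such that $u\sim_\Lambda v$ implies $u^\alpha\sim_\Lambda v^\beta$. A TFS-morphism of $\Gamma$ is a pair $(\alpha,\beta)$ of permutations of $V(\Gamma)$ such that $u^\alpha\sim_\Gamma u^\beta$ for every vertex $u$, and for each pair of adjacent vertices $u,v$, either $u^\alpha\sim_\Gamma v^\beta$ or $u^\alpha=v^\beta$. The complement $\overline{\Gamma}$ has vertex set $V(\Gamma)$ with $u\sim v$ iff $u\ne v$ and $u\not\sim_\Gamma v$. -}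

module Defs where

open import Level using (Level; suc; _⊔_)
open import Data.Nat using (ℕ)
open import Data.Fin using (Fin)
open import Data.Fin.Permutation using (Permutation′; _⟨$⟩ʳ_; _∘ₚ_; flip)
open import Data.Product using (_×_)
open import Data.Sum using (_⊎_)
open import Relation.Nullary using (¬_; Dec)
open import Relation.Binary.PropositionalEquality using (_≡_; _≢_)

record Graph (n : ℕ) : Set₁ where
  field
    _∼_   : Fin n → Fin n → Set
    dec   : ∀ u v → Dec (u ∼ v)
    sym   : ∀ {u v} → u ∼ v → v ∼ u
    irrefl : ∀ {u} → ¬ (u ∼ u)

open Graph public

complement : ∀ {n} → Graph n → Graph n
complement {n} Γ = record
  { _∼_ = λ u v → (u ≢ v) × ¬ (_∼_ Γ u v)
  ; dec = decC
  ; sym = λ { (p , q) → (λ e → p (≡sym e)) , (λ a → q (Graph.sym Γ a)) }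
  ; irrefl = λ { (p , _) → p _≡_.refl }
  }
  where
  open import Data.Product using (_,_)
  open import Relation.Binary.PropositionalEquality using () renaming (sym to ≡sym)
  open import Data.Fin using (_≟_)
  open import Relation.Nullary using (_×-dec_; ¬?)
  decC : ∀ u v → Dec ((u ≢ v) × ¬ (_∼_ Γ u v))
  decC u v = ¬? (u ≟ v) ×-dec ¬? (dec Γ u v)

Derangement : ∀ {n} → Permutation′ n → Set
Derangement {n} π = ∀ (x : Fin n) → π ⟨$⟩ʳ x ≢ x

IsTFMorphism : ∀ {n} → Graph n → Permutation′ n → Permutation′ n → Set
IsTFMorphism Λ α β = ∀ u v → _∼_ Λ u v → _∼_ Λ (α ⟨$⟩ʳ u) (β ⟨$⟩ʳ v)

IsTFSMorphism : ∀ {n} → Graph n → Permutation′ n → Permutation′ n → Set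
IsTFSMorphism Γ α β =
  (∀ u → _∼_ Γ (α ⟨$⟩ʳ u) (β ⟨$⟩ʳ u)) ×
  (∀ u v → _∼_ Γ u v → _∼_ Γ (α ⟨$⟩ʳ u) (β ⟨$⟩ʳ v) ⊎ (α ⟨$⟩ʳ u ≡ β ⟨$⟩ʳ v))

{-# OPTIONS --safe #-}
-- A pair of permutations (α, β) acts as a permutation of the finite set of vertex pairs, so if it
-- maps a decidable relation into itself, it maps it onto itself (count the related pairs).  A
-- TFS-morphism of Γ is exactly a pair preserving the reflexive closure of Γ's adjacency with α u ≠ β u,
-- and the complement of that reflexive closure is the adjacency of the complement of Γ.
module Submission where

open import Defs
open import Level using (Level; _⊔_)
open import Data.Nat using (ℕ; zero; suc; _+_; _≤_; z≤n; s≤s)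
open import Data.Nat.Properties
  using (+-0-commutativeMonoid; +-mono-≤; +-mono-<-≤; +-cancelˡ-≡; ≤-antisym; ≮⇒≥; <-irrefl)
open import Data.Fin using (Fin; zero; suc; _≟_)
open import Data.Fin.Permutation using (Permutation′; _∘ₚ_; flip; _⟨$⟩ʳ_; _⟨$⟩ˡ_; inverseˡ; inverseʳ)
open import Data.Product using (_×_; _,_; proj₁; proj₂)
open import Data.Sum using (_⊎_; inj₁; inj₂)
open import Function using (_∘_)
open import Function.Bundles using (_⇔_; mk⇔)
open import Relation.Binary using (Rel; Decidable)
open import Relation.Binary.Construct.Closure.Reflexive using (ReflClosure; refl; [_]; reflexive)
import Relation.Binary.Construct.Closure.Reflexive.Properties as ReflClosure
open import Relation.Binary.PropositionalEquality using (_≡_; _≢_; cong; trans; subst) renaming (refl to ≡-refl; sym to ≡-sym)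
open import Relation.Nullary using (¬_; Dec; yes; no; contradiction)
open import Algebra.Properties.CommutativeMonoid.Sum +-0-commutativeMonoid using (sum; sum-permute; sum-cong-≗)

private
  variable
    a ℓ : Level
    A : Set a
    m n : ℕ

+-≤-≡⇒≡ : ∀ {w x y z} → w ≤ y → x ≤ z → w + x ≡ y + z → w ≡ y × x ≡ z
+-≤-≡⇒≡ {w} {x} {y} w≤y x≤z eq = w≡y , +-cancelˡ-≡ w _ _ (trans eq (cong (_+ _) (≡-sym w≡y)))
  where
  w≡y : w ≡ y
  w≡y = ≤-antisym w≤y (≮⇒≥ λ w<y → <-irrefl eq (+-mono-<-≤ w<y x≤z))

sum-mono-≤ : {f g : Fin m → ℕ} → (∀ i → f i ≤ g i) → sum f ≤ sum g
sum-mono-≤ {zero}  f≤g = z≤n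
sum-mono-≤ {suc m} f≤g = +-mono-≤ (f≤g zero) (sum-mono-≤ (f≤g ∘ suc))

sum-≤-≡⇒≗ : {f g : Fin m → ℕ} → (∀ i → f i ≤ g i) → sum f ≡ sum g → ∀ i → f i ≡ g i
sum-≤-≡⇒≗ {suc m} f≤g eq zero    = proj₁ (+-≤-≡⇒≡ (f≤g zero) (sum-mono-≤ (f≤g ∘ suc)) eq)
sum-≤-≡⇒≗ {suc m} f≤g eq (suc i) =
  sum-≤-≡⇒≗ (f≤g ∘ suc) (proj₂ (+-≤-≡⇒≡ (f≤g zero) (sum-mono-≤ (f≤g ∘ suc)) eq)) i

indicator : {P : Set ℓ} → Dec P → ℕ
indicator (yes _) = 1
indicator (no _)  = 0

indicator-mono : {P Q : Set ℓ} → (P → Q) → (p : Dec P) (q : Dec Q) → indicator p ≤ indicator q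
indicator-mono P⇒Q (yes p) (yes q) = s≤s z≤n
indicator-mono P⇒Q (yes p) (no ¬q) = contradiction (P⇒Q p) ¬q
indicator-mono P⇒Q (no ¬p) q       = z≤n

indicator-≡⇒reflects : {P Q : Set ℓ} (p : Dec P) (q : Dec Q) → indicator p ≡ indicator q → Q → P
indicator-≡⇒reflects (yes p) q       eq  _ = p
indicator-≡⇒reflects (no ¬p) (yes q) ()  _
indicator-≡⇒reflects (no ¬p) (no ¬q) eq  q = contradiction q ¬q

Preserves : Rel A ℓ → (A → A) → (A → A) → Set _
Preserves R f g = ∀ x y → R x y → R (f x) (g y)

Reflects : Rel A ℓ → (A → A) → (A → A) → Set _
Reflects R f g = ∀ x y → R (f x) (g y) → R x y

module _ {R : Rel (Fin n) ℓ} (R? : Decidable R) (α β : Permutation′ n) where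

  private
    count : Fin n → Fin n → ℕ
    count u v = indicator (R? u v)

    count-moved : Fin n → Fin n → ℕ
    count-moved u v = count (α ⟨$⟩ʳ u) (β ⟨$⟩ʳ v)

  preserves⇒reflects : Preserves R (α ⟨$⟩ʳ_) (β ⟨$⟩ʳ_) → Reflects R (α ⟨$⟩ʳ_) (β ⟨$⟩ʳ_)
  preserves⇒reflects preserves u v = indicator-≡⇒reflects (R? u v) _ (count≡count-moved u v)
    where
    count≤count-moved : ∀ u v → count u v ≤ count-moved u v
    count≤count-moved u v = indicator-mono (preserves u v) _ _

    total≡ : sum (sum ∘ count) ≡ sum (sum ∘ count-moved)
    total≡ = trans (sum-permute (sum ∘ count) α)
                   (sum-cong-≗ λ u → sum-permute (count (α ⟨$⟩ʳ u)) β)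

    row≡ : ∀ u → sum (count u) ≡ sum (count-moved u)
    row≡ = sum-≤-≡⇒≗ (λ u → sum-mono-≤ (count≤count-moved u)) total≡

    count≡count-moved : ∀ u v → count u v ≡ count-moved u v
    count≡count-moved u = sum-≤-≡⇒≗ (count≤count-moved u) (row≡ u)

record Complementary {A : Set a} (R Q : Rel A ℓ) : Set (a ⊔ ℓ) where
  field
    exhaustive : ∀ x y → R x y ⊎ Q x y
    disjoint   : ∀ {x y} → R x y → ¬ Q x y

  swap : Complementary Q R
  swap = record
    { exhaustive = λ x y → Data.Sum.swap (exhaustive x y)
    ; disjoint   = λ q r → disjoint r q
    }

  reflects⇒preserves : {f g : A → A} → Reflects R f g → Preserves Q f g
  reflects⇒preserves reflects x y q with exhaustive _ _
  ... | inj₁ r   = contradiction q (disjoint (reflects x y r))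
  ... | inj₂ q′ = q′

module _ {n} (Γ : Graph n) where

  AdjacentOrEqual : Rel (Fin n) _
  AdjacentOrEqual = ReflClosure (_∼_ Γ)

  adjacentOrEqual? : Decidable AdjacentOrEqual
  adjacentOrEqual? = ReflClosure.dec _≟_ (dec Γ)

  complementary : Complementary AdjacentOrEqual (_∼_ (complement Γ))
  complementary = record { exhaustive = exhaustive ; disjoint = disjoint }
    where
    exhaustive : ∀ u v → AdjacentOrEqual u v ⊎ _∼_ (complement Γ) u v
    exhaustive u v with u ≟ v | dec Γ u v
    ... | yes ≡-refl | _       = inj₁ refl
    ... | no u≢v     | yes u∼v = inj₁ [ u∼v ]
    ... | no u≢v     | no u≁v  = inj₂ (u≢v , u≁v)

    disjoint : ∀ {u v} → AdjacentOrEqual u v → ¬ _∼_ (complement Γ) u v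
    disjoint refl    (u≢u , _)   = u≢u ≡-refl
    disjoint [ u∼v ] (_   , u≁v) = u≁v u∼v

derangement⇒≢ : (α β : Permutation′ n) → Derangement (α ∘ₚ flip β) → ∀ x → α ⟨$⟩ʳ x ≢ β ⟨$⟩ʳ x
derangement⇒≢ α β derangement x eq = derangement x (trans (cong (β ⟨$⟩ˡ_) eq) (inverseˡ β))

≢⇒derangement : (α β : Permutation′ n) → (∀ x → α ⟨$⟩ʳ x ≢ β ⟨$⟩ʳ x) → Derangement (α ∘ₚ flip β)
≢⇒derangement α β α≢β x eq = α≢β x (trans (≡-sym (inverseʳ β)) (cong (β ⟨$⟩ʳ_) eq))

module _ {n} (Γ : Graph n) (α β : Permutation′ n) where

  IsTFSMorphism⇒preserves : IsTFSMorphism Γ α β → Preserves (AdjacentOrEqual Γ) (α ⟨$⟩ʳ_) (β ⟨$⟩ʳ_)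
  IsTFSMorphism⇒preserves (diagonal , adjacent) u v [ u∼v ] with adjacent u v u∼v
  ... | inj₁ αu∼βv = [ αu∼βv ]
  ... | inj₂ αu≡βv = reflexive αu≡βv
  IsTFSMorphism⇒preserves (diagonal , adjacent) u u refl = [ diagonal u ]

  IsTFSMorphism⇒derangement : IsTFSMorphism Γ α β → Derangement (α ∘ₚ flip β)
  IsTFSMorphism⇒derangement (diagonal , _) = ≢⇒derangement α β λ x eq →
    irrefl Γ (subst (λ y → _∼_ Γ y (β ⟨$⟩ʳ x)) eq (diagonal x))

  preserves⇒IsTFSMorphism : Derangement (α ∘ₚ flip β) →
    Preserves (AdjacentOrEqual Γ) (α ⟨$⟩ʳ_) (β ⟨$⟩ʳ_) → IsTFSMorphism Γ α β
  preserves⇒IsTFSMorphism derangement preserves = diagonal , adjacent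
    where
    diagonal : ∀ u → _∼_ Γ (α ⟨$⟩ʳ u) (β ⟨$⟩ʳ u)
    diagonal u with ReflClosure.toSum (preserves u u refl)
    ... | inj₁ αu≡βu = contradiction αu≡βu (derangement⇒≢ α β derangement u)
    ... | inj₂ αu∼βu = αu∼βu

    adjacent : ∀ u v → _∼_ Γ u v → _∼_ Γ (α ⟨$⟩ʳ u) (β ⟨$⟩ʳ v) ⊎ α ⟨$⟩ʳ u ≡ β ⟨$⟩ʳ v
    adjacent u v u∼v = Data.Sum.swap (ReflClosure.toSum (preserves u v [ u∼v ]))

lemma2p5 : ∀ {n : ℕ} (Γ : Graph n) (α β : Permutation′ n) →
    IsTFSMorphism Γ α β ⇔ (Derangement (α ∘ₚ flip β) × IsTFMorphism (complement Γ) α β)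
lemma2p5 Γ α β = mk⇔
  (λ tfs → IsTFSMorphism⇒derangement Γ α β tfs
         , reflects⇒preserves (complementary Γ)
             (preserves⇒reflects (adjacentOrEqual? Γ) α β (IsTFSMorphism⇒preserves Γ α β tfs)))
  (λ (derangement , tf) → preserves⇒IsTFSMorphism Γ α β derangement
         (reflects⇒preserves (swap (complementary Γ))
             (preserves⇒reflects (dec (complement Γ)) α β tf)))
  where open Complementary
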